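{- Let $\mathcal{C}$ be a chordal clutter on vertex set $V$ with minimum circuit cardinality $d$. Then the Alexander dual (over $V$) of $I(c_d(\mathcal{C}))$ is vertex decomposable.
   Context: A clutter on finite vertex set $V$ is a set of subsets (circuits) of $V$, none properly containing another; minimum circuit cardinality is the smallest circuit size. $I(\mathcal{D})$ is the simplicial complex on $V$ of subsets containing no circuit of $\mathcal{D}$. $c_d(\mathcal{C})$ is the clutter on $V$ whose circuits are the $d$-subsets of $V$ that are not circuits of $\mathcal{C}$. Deletion $\mathcal{C}\setminus u$: clutter on $V\setminus\{u\}$ with the circuits not containing $u$; contraction $\mathcal{C}/u$: clutter on $V\setminus\{u\}$ whose circuits are the minimal sets among $\{e\setminus\{u\}\}$; a minor arises from a (possibly empty) sequence of these. A vertex $v$ is simplicial if for every two circuits $e_1,e_2\ni v$ there is a circuit $e_3\subseteq(e_1\cup e_2)\setminus\{v\}$; $\mathcal{C}$ is chordal if every minor (with at least one vertex) has a simplicial vertex. The Alexander dual over $V$ of a complex $\Delta$ on $V$ has facets $V\setminus e$ for $e$ a minimal non-face of $\Delta$. A complex $\Delta$ on vertex set $W$ is vertex decomposable if it is a simplex, or $\{\}$ or $\{\emptyset\}$, or it has a vertex $v$ such that every face $\tau\ni v$ admits $w\in W\setminus\tau$ with $(\tau\cup\{w\})\setminus\{v\}\in\Delta$, and both $\Delta\setminus v$ (faces not containing $v$) and $\operatorname{link}_\Delta v=\{\tau:v\notin\tau,\tau\cup\{v\}\in\Delta\}$ are vertex decomposable. -}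

module Defs where

open import Data.Nat using (ℕ; _≤_)
open import Data.Fin using (Fin)
open import Data.Fin.Subset
  using (Subset; _∈_; _∉_; _⊆_; _⊂_; _∪_; _─_; _-_; ∣_∣; ⁅_⁆)
  renaming (⊥ to ∅)
open import Data.Product using (Σ; ∃; ∃-syntax; _×_; _,_)
open import Data.Empty using (⊥)
open import Relation.Nullary using (¬_; Dec)
open import Relation.Binary.PropositionalEquality using (_≡_)
open import Function.Bundles using (_⇔_)

-- Vertices are drawn from the universe Fin n; a finite vertex set is a
-- Subset n.  A family of subsets (set of circuits / faces) is a predicate.
Family : ℕ → Set₁
Family n = Subset n → Set

record Clutter (n : ℕ) : Set₁ where
  field
    V       : Subset n
    circ    : Family n
    circ-dec : ∀ e → Dec (circ e)   -- a (finite) set of subsets is decidable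
    circ⊆V  : ∀ e → circ e → e ⊆ V
    antichain : ∀ e f → circ e → circ f → ¬ (e ⊂ f)

open Clutter public

MinCircuitCard : ∀ {n} → Clutter n → ℕ → Set
MinCircuitCard C d =
  (∃[ e ] (circ C e × ∣ e ∣ ≡ d)) × (∀ e → circ C e → d ≤ ∣ e ∣)

Del : ∀ {n} → Family n → Fin n → Family n
Del P u e = P e × u ∉ e

Con : ∀ {n} → Family n → Fin n → Family n
Con P u e = (∃[ f ] (P f × f - u ≡ e)) × (∀ f → P f → ¬ (f - u ⊂ e))

data Minor {n : ℕ} (V : Subset n) (P : Family n) : Subset n → Family n → Set₁ where
  here : Minor V P V P
  del  : ∀ {W Q u} → Minor V P W Q → u ∈ W → Minor V P (W - u) (Del Q u)
  con  : ∀ {W Q u} → Minor V P W Q → u ∈ W → Minor V P (W - u) (Con Q u)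

Simplicial : ∀ {n} → Subset n → Family n → Fin n → Set
Simplicial W Q v =
  v ∈ W ×
  (∀ e₁ e₂ → Q e₁ → Q e₂ → v ∈ e₁ → v ∈ e₂ → ¬ (e₁ ≡ e₂) →
     ∃[ e₃ ] (Q e₃ × e₃ ⊆ (e₁ ∪ e₂) - v))

Chordal : ∀ {n} → Clutter n → Set₁
Chordal C = ∀ W Q → Minor (V C) (circ C) W Q →
  (∃[ x ] (x ∈ W)) → ∃[ v ] Simplicial W Q v

cd : ∀ {n} → Clutter n → ℕ → Family n
cd C d e = e ⊆ V C × ∣ e ∣ ≡ d × ¬ circ C e

Ind : ∀ {n} → Subset n → Family n → Family n
Ind V D τ = τ ⊆ V × (∀ e → D e → ¬ (e ⊆ τ))

MinNonFace : ∀ {n} → Subset n → Family n → Family n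
MinNonFace V Δ e = e ⊆ V × ¬ Δ e × (∀ f → f ⊂ e → Δ f)

AlexDual : ∀ {n} → Subset n → Family n → Family n
AlexDual V Δ σ = ∃[ e ] (MinNonFace V Δ e × σ ⊆ V ─ e)

data VertexDecomposable {n : ℕ} : Subset n → Family n → Set₁ where
  simplex : ∀ {W Δ} (F : Subset n) → F ⊆ W → (∀ τ → Δ τ ⇔ τ ⊆ F) →
            VertexDecomposable W Δ
  void    : ∀ {W Δ} → (∀ τ → ¬ Δ τ) → VertexDecomposable W Δ
  -- {∅} is the simplex with F = ∅, but we list it for fidelity
  irrel   : ∀ {W Δ} → (∀ τ → Δ τ ⇔ τ ≡ ∅) → VertexDecomposable W Δ
  shed    : ∀ {W Δ} (v : Fin n) → v ∈ W →
            (∀ τ → Δ τ → v ∈ τ → ∃[ w ] (w ∈ W × w ∉ τ × Δ ((τ ∪ ⁅ w ⁆) - v))) →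
            VertexDecomposable (W - v) (λ τ → v ∉ τ × Δ τ) →
            VertexDecomposable (W - v) (λ τ → v ∉ τ × Δ (τ ∪ ⁅ v ⁆)) →
            VertexDecomposable W Δ

module Submission where

-- The members of c_d(C) all have size d, so they are exactly the minimal
-- non-faces of I(c_d(C)); the Alexander dual is therefore the complex
--   Γ V C d = { σ ⊆ V : σ misses some d-subset of V that is not a circuit }.
-- We show that Γ W Q d is vertex decomposable for every decidable family Q
-- on W which is hereditarily chordal and has no member smaller than d, by
-- induction on |W|.  The key notion is the exchange property of a vertex v:
-- every non-circuit d-set e ∌ v contains some w with e - w + v again not a
-- circuit.  Such a v is a shedding vertex of Γ W Q d, whose link and deletion
-- are Γ (W - v) (Q ∖ v) d and Γ (W - v) (Q / v) (d - 1); both minors are again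
-- chordal, so induction applies.  Exchange vertices exist: for d = 1 any
-- non-loop works (and without one Γ is empty), for d ≥ 2 a simplicial vertex,
-- supplied by chordality, works.

open import Defs
open import Data.Nat using (ℕ; zero; suc; _≤_; _<_; z≤n; s≤s)
open import Data.Nat.Properties
  using (≤-refl; ≤-trans; ≤-<-trans; <-irrefl; <⇒≱; ≤-pred; m≤n⇒m≤1+n; ≤-reflexive; suc-injective; module ≤-Reasoning)
  renaming (_≟_ to _≟ℕ_)
open import Data.Fin using (Fin; zero; suc) renaming (_≟_ to _≟ᶠ_)
open import Data.Fin.Properties using (any?)
open import Data.Fin.Subset
  using (Subset; _∈_; _∉_; _⊆_; _⊂_; _∪_; _─_; _-_; ∣_∣; ⁅_⁆; inside; outside; Nonempty)
  renaming (⊥ to ∅)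
open import Data.Fin.Subset.Properties
open import Data.Bool using () renaming (_≟_ to _≟ᵇ_)
open import Data.Vec using (_∷_)
open import Data.Vec.Base using (here; there)
open import Data.Vec.Properties using (≡-dec)
open import Data.Product using (∃-syntax; _×_; _,_; proj₁; proj₂)
open import Data.Sum using (_⊎_; inj₁; inj₂; [_,_]′)
open import Data.Empty using (⊥-elim)
open import Relation.Nullary using (¬_; Dec; yes; no)
open import Relation.Nullary.Decidable using (_×-dec_; ¬?)
open import Relation.Binary.PropositionalEquality
  using (_≡_; _≢_; refl; sym; trans; cong; subst; subst₂; module ≡-Reasoning)
open import Function.Bundles using (_⇔_; mk⇔; Equivalence)
open import Function.Construct.Symmetry using (⇔-sym)
open import Function.Construct.Composition using (_⇔-∘_)

∣p∣≡1+∣p-x∣ : ∀ {n} (p : Subset n) x → x ∈ p → ∣ p ∣ ≡ suc ∣ p - x ∣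
∣p∣≡1+∣p-x∣ (inside ∷ p) zero here = cong suc (sym (cong ∣_∣ (p─⊥≡p p)))
∣p∣≡1+∣p-x∣ (inside ∷ p) (suc x) (there x∈p) = cong suc (∣p∣≡1+∣p-x∣ p x x∈p)
∣p∣≡1+∣p-x∣ (outside ∷ p) (suc x) (there x∈p) = ∣p∣≡1+∣p-x∣ p x x∈p

∣p-x∣≡k : ∀ {n} (p : Subset n) x {k} → x ∈ p → ∣ p ∣ ≡ suc k → ∣ p - x ∣ ≡ k
∣p-x∣≡k p x x∈p ∣p∣≡1+k = suc-injective (trans (sym (∣p∣≡1+∣p-x∣ p x x∈p)) ∣p∣≡1+k)

∈─⇒∉ : ∀ {n} (p q : Subset n) {x} → x ∈ p ─ q → x ∉ q
∈─⇒∉ (s ∷ p) (inside ∷ q) () here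
∈─⇒∉ (s ∷ p) (t ∷ q) (there x∈p─q) (there x∈q) = ∈─⇒∉ p q x∈p─q x∈q

∈-⇒≢ : ∀ {n} (p : Subset n) {x y} → x ∈ p - y → x ≢ y
∈-⇒≢ p {y = y} x∈p-y refl = ∈─⇒∉ p ⁅ y ⁆ x∈p-y (x∈⁅x⁆ y)

∈-⇒∈ : ∀ {n} (p : Subset n) {x y} → x ∈ p - y → x ∈ p
∈-⇒∈ p {y = y} = p─q⊆p p ⁅ y ⁆

⊆-⇒⊆ : ∀ {n} {σ W : Subset n} {v} → σ ⊆ W - v → σ ⊆ W
⊆-⇒⊆ {W = W} σ⊆W-v x∈σ = ∈-⇒∈ W (σ⊆W-v x∈σ)

⊆-⇒∉ : ∀ {n} {σ W : Subset n} {v} → σ ⊆ W - v → v ∉ σ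
⊆-⇒∉ {W = W} σ⊆W-v v∈σ = ∈-⇒≢ W (σ⊆W-v v∈σ) refl

⊆-⁺ : ∀ {n} {σ W : Subset n} {v} → σ ⊆ W → v ∉ σ → σ ⊆ W - v
⊆-⁺ σ⊆W v∉σ x∈σ = x∈p∧x≢y⇒x∈p-y (σ⊆W x∈σ) (λ { refl → v∉σ x∈σ })

-⁺ : ∀ {n} {σ W : Subset n} {v} → σ ⊆ W → σ - v ⊆ W - v
-⁺ {σ = σ} σ⊆W x∈σ-v = x∈p∧x≢y⇒x∈p-y (σ⊆W (∈-⇒∈ σ x∈σ-v)) (∈-⇒≢ σ x∈σ-v)

∪⁅⁆⊆ : ∀ {n} {σ W : Subset n} {v} → σ ⊆ W → v ∈ W → σ ∪ ⁅ v ⁆ ⊆ W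
∪⁅⁆⊆ {σ = σ} {W} {v} σ⊆W v∈W x∈ =
  [ σ⊆W , (λ x∈⁅v⁆ → subst (_∈ W) (sym (x∈⁅y⁆⇒x≡y v x∈⁅v⁆)) v∈W) ]′ (x∈p∪q⁻ σ ⁅ v ⁆ x∈)

x∈p∪⁅x⁆ : ∀ {n} (p : Subset n) x → x ∈ p ∪ ⁅ x ⁆
x∈p∪⁅x⁆ p x = x∈p∪q⁺ (inj₂ (x∈⁅x⁆ x))

p∪⁅x⁆-x≡p : ∀ {n} (p : Subset n) x → x ∉ p → (p ∪ ⁅ x ⁆) - x ≡ p
p∪⁅x⁆-x≡p p x x∉p = ⊆-antisym ⊆p p⊆
  where
  ⊆p : (p ∪ ⁅ x ⁆) - x ⊆ p
  ⊆p y∈ = [ (λ y∈p → y∈p) , (λ y∈⁅x⁆ → ⊥-elim (∈-⇒≢ _ y∈ (x∈⁅y⁆⇒x≡y x y∈⁅x⁆))) ]′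
            (x∈p∪q⁻ p ⁅ x ⁆ (∈-⇒∈ _ y∈))
  p⊆ : p ⊆ (p ∪ ⁅ x ⁆) - x
  p⊆ y∈p = x∈p∧x≢y⇒x∈p-y (x∈p∪q⁺ (inj₁ y∈p)) (λ { refl → x∉p y∈p })

∣p∪⁅x⁆∣≡1+∣p∣ : ∀ {n} (p : Subset n) x → x ∉ p → ∣ p ∪ ⁅ x ⁆ ∣ ≡ suc ∣ p ∣
∣p∪⁅x⁆∣≡1+∣p∣ p x x∉p =
  trans (∣p∣≡1+∣p-x∣ (p ∪ ⁅ x ⁆) x (x∈p∪⁅x⁆ p x)) (cong (λ q → suc ∣ q ∣) (p∪⁅x⁆-x≡p p x x∉p))

∣p∣≤1+∣p-x∣ : ∀ {n} (p : Subset n) x → ∣ p ∣ ≤ suc ∣ p - x ∣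
∣p∣≤1+∣p-x∣ p x with x ∈? p
... | yes x∈p = ≤-reflexive (∣p∣≡1+∣p-x∣ p x x∈p)
... | no x∉p = m≤n⇒m≤1+n (p⊆q⇒∣p∣≤∣q∣ (⊆-⁺ (λ y∈p → y∈p) x∉p))

⊆∧∣≥∣⇒≡ : ∀ {n} {p q : Subset n} → p ⊆ q → ∣ q ∣ ≤ ∣ p ∣ → p ≡ q
⊆∧∣≥∣⇒≡ {p = p} {q} p⊆q ∣q∣≤∣p∣ with p ⊂? q
... | yes p⊂q = ⊥-elim (<⇒≱ (p⊂q⇒∣p∣<∣q∣ p⊂q) ∣q∣≤∣p∣)
... | no p⊄q = ⊆-antisym p⊆q q⊆p
  where
  q⊆p : q ⊆ p
  q⊆p {x} x∈q with x ∈? p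
  ... | yes x∈p = x∈p
  ... | no x∉p = ⊥-elim (p⊄q (p⊆q , x , x∈q , x∉p))

∣p∣≡0⇒p≡∅ : ∀ {n} {p : Subset n} → ∣ p ∣ ≡ 0 → p ≡ ∅
∣p∣≡0⇒p≡∅ {n} ∣p∣≡0 = sym (⊆∧∣≥∣⇒≡ ⊥⊆ (subst (_≤ ∣ ∅ {n} ∣) (sym ∣p∣≡0) z≤n))

∣p∣≡1+k⇒nonempty : ∀ {n} (p : Subset n) {k} → ∣ p ∣ ≡ suc k → Nonempty p
∣p∣≡1+k⇒nonempty {n} p ∣p∣≡1+k with nonempty? p
... | yes ne = ne
... | no empty with trans (sym (∣⊥∣≡0 n)) (trans (cong ∣_∣ (sym (Empty-unique empty))) ∣p∣≡1+k)
...   | ()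

_[_↦_] : ∀ {n} → Subset n → Fin n → Fin n → Subset n
e [ w ↦ v ] = (e - w) ∪ ⁅ v ⁆

∈-swap⁻ : ∀ {n} (e : Subset n) w v {x} → x ∈ e [ w ↦ v ] → (x ∈ e × x ≢ w) ⊎ x ≡ v
∈-swap⁻ e w v x∈ with x∈p∪q⁻ (e - w) ⁅ v ⁆ x∈
... | inj₁ x∈e-w = inj₁ (∈-⇒∈ e x∈e-w , ∈-⇒≢ e x∈e-w)
... | inj₂ x∈⁅v⁆ = inj₂ (x∈⁅y⁆⇒x≡y v x∈⁅v⁆)

∈-swap⇒∈ : ∀ {n} {e : Subset n} {w v x} → x ∈ e [ w ↦ v ] → x ≢ v → x ∈ e
∈-swap⇒∈ {e = e} {w} {v} x∈ x≢v with ∈-swap⁻ e w v x∈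
... | inj₁ (x∈e , _) = x∈e
... | inj₂ x≡v = ⊥-elim (x≢v x≡v)

∣swap∣ : ∀ {n} {e : Subset n} {w v} → w ∈ e → v ∉ e → ∣ e [ w ↦ v ] ∣ ≡ ∣ e ∣
∣swap∣ {e = e} {w} {v} w∈e v∉e =
  trans (∣p∪⁅x⁆∣≡1+∣p∣ (e - w) v (λ v∈e-w → v∉e (∈-⇒∈ e v∈e-w))) (sym (∣p∣≡1+∣p-x∣ e w w∈e))

swaps-differ : ∀ {n} {e : Subset n} {w₁ w₂ v} → w₂ ∈ e - w₁ → v ∉ e →
  e [ w₁ ↦ v ] ≢ e [ w₂ ↦ v ]
swaps-differ {e = e} {w₁} {w₂} {v} w₂∈e-w₁ v∉e eq
  with ∈-swap⁻ e w₂ v (subst (w₂ ∈_) eq (x∈p∪q⁺ (inj₁ w₂∈e-w₁)))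
... | inj₁ (_ , w₂≢w₂) = w₂≢w₂ refl
... | inj₂ refl = v∉e (∈-⇒∈ e w₂∈e-w₁)

minor-trans : ∀ {n} {V : Subset n} {P W₁ Q₁ W₂ Q₂} →
  Minor V P W₁ Q₁ → Minor W₁ Q₁ W₂ Q₂ → Minor V P W₂ Q₂
minor-trans m here = m
minor-trans m (del m' u∈W) = del (minor-trans m m') u∈W
minor-trans m (con m' u∈W) = con (minor-trans m m') u∈W

HChordal : ∀ {n} → Subset n → Family n → Set₁
HChordal W Q = ∀ W' Q' → Minor W Q W' Q' → Nonempty W' → ∃[ v ] Simplicial W' Q' v

HChordal-del : ∀ {n} {W : Subset n} {Q u} → HChordal W Q → u ∈ W → HChordal (W - u) (Del Q u)
HChordal-del ch u∈W W' Q' m = ch W' Q' (minor-trans (del here u∈W) m)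

HChordal-con : ∀ {n} {W : Subset n} {Q u} → HChordal W Q → u ∈ W → HChordal (W - u) (Con Q u)
HChordal-con ch u∈W W' Q' m = ch W' Q' (minor-trans (con here u∈W) m)

Del-dec : ∀ {n} {Q : Family n} u → (∀ e → Dec (Q e)) → ∀ e → Dec (Del Q u e)
Del-dec u Q? e = Q? e ×-dec ¬? (u ∈? e)

Con-dec : ∀ {n} {Q : Family n} u → (∀ e → Dec (Q e)) → ∀ e → Dec (Con Q u e)
Con-dec u Q? e
  with anySubset? (λ f → Q? f ×-dec ≡-dec _≟ᵇ_ (f - u) e)
     | anySubset? (λ f → Q? f ×-dec ((f - u) ⊂? e))
... | no ¬image | _ = no (λ c → ¬image (proj₁ c))
... | yes image | yes (f , Qf , f-u⊂e) = no (λ c → proj₂ c f Qf f-u⊂e)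
... | yes image | no ¬smaller = yes (image , λ f Qf f-u⊂e → ¬smaller (f , Qf , f-u⊂e))

Con-size : ∀ {n} {Q : Family n} {d} u → (∀ e → Q e → suc d ≤ ∣ e ∣) → ∀ e → Con Q u e → d ≤ ∣ e ∣
Con-size u sz e ((f , Qf , f-u≡e) , _) =
  ≤-pred (≤-trans (sz f Qf) (subst (λ g → ∣ f ∣ ≤ suc ∣ g ∣) f-u≡e (∣p∣≤1+∣p-x∣ f u)))

VD-cong : ∀ {n} {W : Subset n} {Δ Δ' : Family n} → VertexDecomposable W Δ →
  (∀ τ → Δ τ ⇔ Δ' τ) → VertexDecomposable W Δ'
VD-cong (simplex F F⊆W Δ≡F) Δ⇔Δ' = simplex F F⊆W (λ τ → Δ≡F τ ⇔-∘ ⇔-sym (Δ⇔Δ' τ))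
VD-cong (void Δ-empty) Δ⇔Δ' = void (λ τ τ∈Δ' → Δ-empty τ (Equivalence.from (Δ⇔Δ' τ) τ∈Δ'))
VD-cong (irrel Δ≡∅) Δ⇔Δ' = irrel (λ τ → Δ≡∅ τ ⇔-∘ ⇔-sym (Δ⇔Δ' τ))
VD-cong {Δ = Δ} {Δ'} (shed v v∈W trade vd-del vd-link) Δ⇔Δ' =
  shed v v∈W trade' (VD-cong vd-del (λ τ → on-face τ (Δ⇔Δ' τ)))
                    (VD-cong vd-link (λ τ → on-face τ (Δ⇔Δ' (τ ∪ ⁅ v ⁆))))
  where
  on-face : ∀ {A B : Set} τ → A ⇔ B → (v ∉ τ × A) ⇔ (v ∉ τ × B)
  on-face _ A⇔B = mk⇔ (λ { (v∉ , a) → v∉ , Equivalence.to A⇔B a })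
                    (λ { (v∉ , b) → v∉ , Equivalence.from A⇔B b })
  trade' : ∀ τ → Δ' τ → v ∈ τ → ∃[ w ] (w ∈ _ × w ∉ τ × Δ' ((τ ∪ ⁅ w ⁆) - v))
  trade' τ τ∈Δ' v∈τ with trade τ (Equivalence.from (Δ⇔Δ' τ) τ∈Δ') v∈τ
  ... | w , w∈W , w∉τ , τ'∈Δ = w , w∈W , w∉τ , Equivalence.to (Δ⇔Δ' _) τ'∈Δ

Disjoint : ∀ {n} → Subset n → Subset n → Set
Disjoint σ e = ∀ {x} → x ∈ σ → x ∉ e

Disjoint-sym : ∀ {n} {σ e : Subset n} → Disjoint σ e → Disjoint e σ
Disjoint-sym σ∩e x∈e x∈σ = σ∩e x∈σ x∈e

Disjoint-∪⁅⁆ : ∀ {n} {σ e : Subset n} {v} → Disjoint σ e → v ∉ e → Disjoint (σ ∪ ⁅ v ⁆) e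
Disjoint-∪⁅⁆ {σ = σ} {e} {v} σ∩e v∉e x∈ =
  [ σ∩e , (λ x∈⁅v⁆ → subst (_∉ e) (sym (x∈⁅y⁆⇒x≡y v x∈⁅v⁆)) v∉e) ]′ (x∈p∪q⁻ σ ⁅ v ⁆ x∈)

Avoid : ∀ {n} → Subset n → Family n → Family n
Avoid V D σ = σ ⊆ V × ∃[ e ] (D e × Disjoint σ e)

NonCircuit : ∀ {n} → Subset n → Family n → ℕ → Family n
NonCircuit W Q d e = e ⊆ W × ∣ e ∣ ≡ d × ¬ Q e

Γ : ∀ {n} → Subset n → Family n → ℕ → Family n
Γ W Q d = Avoid W (NonCircuit W Q d)

no-circuit-below : ∀ {n} {W : Subset n} {Q d e f} → (∀ g → Q g → d ≤ ∣ g ∣) →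
  NonCircuit W Q d e → f ⊆ e → ¬ Q f
no-circuit-below {Q = Q} {f = f} sz (_ , ∣e∣≡d , ¬Qe) f⊆e Qf =
  ¬Qe (subst Q (⊆∧∣≥∣⇒≡ f⊆e (subst (_≤ ∣ f ∣) (sym ∣e∣≡d) (sz f Qf))) Qf)

Exchange : ∀ {n} → Subset n → Family n → ℕ → Fin n → Set
Exchange W Q d v = ∀ e → NonCircuit W Q d e → v ∉ e → ∃[ w ] (w ∈ e × ¬ Q (e [ w ↦ v ]))

swap-NonCircuit : ∀ {n} {W : Subset n} {Q d e w v} → v ∈ W → NonCircuit W Q d e →
  w ∈ e → v ∉ e → ¬ Q (e [ w ↦ v ]) → NonCircuit W Q d (e [ w ↦ v ])
swap-NonCircuit {e = e} v∈W (e⊆W , ∣e∣≡d , _) w∈e v∉e ¬Q' =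
  ∪⁅⁆⊆ (λ x∈e-w → e⊆W (∈-⇒∈ e x∈e-w)) v∈W , trans (∣swap∣ w∈e v∉e) ∣e∣≡d , ¬Q'

-- For d = 1 every non-loop v has the exchange property: e [ w ↦ v ] = ⁅ v ⁆.
loopless⇒exchange : ∀ {n} {W : Subset n} {Q v} → ¬ Q ⁅ v ⁆ → Exchange W Q 1 v
loopless⇒exchange {Q = Q} {v} ¬Qv e (_ , ∣e∣≡1 , _) _ with ∣p∣≡1+k⇒nonempty e ∣e∣≡1
... | w , w∈e = w , w∈e , λ Q' → ¬Qv (subst Q e[w↦v]≡⁅v⁆ Q')
  where
  open ≡-Reasoning
  e[w↦v]≡⁅v⁆ : e [ w ↦ v ] ≡ ⁅ v ⁆
  e[w↦v]≡⁅v⁆ = begin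
    (e - w) ∪ ⁅ v ⁆ ≡⟨ cong (_∪ ⁅ v ⁆) (∣p∣≡0⇒p≡∅ (∣p-x∣≡k e w w∈e ∣e∣≡1)) ⟩
    ∅ ∪ ⁅ v ⁆       ≡⟨ ∪-identityˡ ⁅ v ⁆ ⟩
    ⁅ v ⁆           ∎

loops-only⇒Γ-empty : ∀ {n} {W : Subset n} {Q} → ¬ (∃[ v ] (v ∈ W × ¬ Q ⁅ v ⁆)) →
  ∀ τ → ¬ Γ W Q 1 τ
loops-only⇒Γ-empty {Q = Q} no-non-loop τ (_ , e , (e⊆W , ∣e∣≡1 , ¬Qe) , _)
  with ∣p∣≡1+k⇒nonempty e ∣e∣≡1
... | w , w∈e = no-non-loop (w , e⊆W w∈e , λ Qw → ¬Qe (subst Q ⁅w⁆≡e Qw))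
  where
  ⁅w⁆≡e : ⁅ w ⁆ ≡ e
  ⁅w⁆≡e = ⊆∧∣≥∣⇒≡ (λ x∈⁅w⁆ → subst (_∈ e) (sym (x∈⁅y⁆⇒x≡y w x∈⁅w⁆)) w∈e)
                   (subst₂ _≤_ (sym ∣e∣≡1) (sym (∣⁅x⁆∣≡1 w)) ≤-refl)

-- For d ≥ 2 a simplicial vertex v has the exchange property: if trading two
-- different elements of e for v gave two circuits, simpliciality would put a
-- circuit inside their union minus v, which lies in e.
simplicial⇒exchange : ∀ {n} {W : Subset n} {Q d v} → (∀ e → Dec (Q e)) →
  (∀ e → Q e → suc (suc d) ≤ ∣ e ∣) → Simplicial W Q v → Exchange W Q (suc (suc d)) v
simplicial⇒exchange {v = v} Q? sz (_ , simp) e nc@(_ , ∣e∣≡2+d , _) v∉e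
  with ∣p∣≡1+k⇒nonempty e ∣e∣≡2+d
... | w₁ , w₁∈e with ∣p∣≡1+k⇒nonempty (e - w₁) (∣p-x∣≡k e w₁ w₁∈e ∣e∣≡2+d)
... | w₂ , w₂∈e-w₁ with Q? (e [ w₁ ↦ v ]) | Q? (e [ w₂ ↦ v ])
... | no ¬Q₁ | _ = w₁ , w₁∈e , ¬Q₁
... | yes _ | no ¬Q₂ = w₂ , ∈-⇒∈ e w₂∈e-w₁ , ¬Q₂
... | yes Q₁ | yes Q₂
  with simp _ _ Q₁ Q₂ (x∈p∪⁅x⁆ _ v) (x∈p∪⁅x⁆ _ v) (swaps-differ w₂∈e-w₁ v∉e)
... | e₃ , Qe₃ , e₃⊆ = ⊥-elim (no-circuit-below sz nc e₃⊆e Qe₃)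
  where
  e₃⊆e : e₃ ⊆ e
  e₃⊆e {x} x∈e₃ = [ (λ x∈₁ → ∈-swap⇒∈ x∈₁ x≢v) , (λ x∈₂ → ∈-swap⇒∈ x∈₂ x≢v) ]′
                     (x∈p∪q⁻ (e [ w₁ ↦ v ]) (e [ w₂ ↦ v ]) (∈-⇒∈ _ (e₃⊆ x∈e₃)))
    where
    x≢v : x ≢ v
    x≢v = ∈-⇒≢ _ (e₃⊆ x∈e₃)

-- Exchange gives the first shedding condition: a face τ ∋ v trades v for a
-- vertex w of the non-circuit it misses.
exchange⇒trade : ∀ {n} {W : Subset n} {Q d v} → v ∈ W → Exchange W Q d v →
  ∀ τ → Γ W Q d τ → v ∈ τ → ∃[ w ] (w ∈ W × w ∉ τ × Γ W Q d ((τ ∪ ⁅ w ⁆) - v))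
exchange⇒trade {Q = Q} {v = v} v∈W ex τ (τ⊆W , e , nc@(e⊆W , _ , _) , τ∩e) v∈τ
  with ex e nc (τ∩e v∈τ)
... | w , w∈e , ¬Q' =
  w , e⊆W w∈e , (λ w∈τ → τ∩e w∈τ w∈e) ,
  (λ x∈ → ∪⁅⁆⊆ τ⊆W (e⊆W w∈e) (∈-⇒∈ _ x∈)) ,
  e [ w ↦ v ] , swap-NonCircuit {Q = Q} v∈W nc w∈e (τ∩e v∈τ) ¬Q' , traded-disjoint
  where
  traded-disjoint : Disjoint ((τ ∪ ⁅ w ⁆) - v) (e [ w ↦ v ])
  traded-disjoint {x} x∈τ' x∈e' with x∈p∪q⁻ τ ⁅ w ⁆ (∈-⇒∈ _ x∈τ') | ∈-swap⁻ e w v x∈e'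
  ... | _ | inj₂ x≡v = ∈-⇒≢ _ x∈τ' x≡v
  ... | inj₁ x∈τ | inj₁ (x∈e , _) = τ∩e x∈τ x∈e
  ... | inj₂ x∈⁅w⁆ | inj₁ (_ , x≢w) = x≢w (x∈⁅y⁆⇒x≡y w x∈⁅w⁆)

link-Γ : ∀ {n} {W : Subset n} {Q d v} → v ∈ W →
  ∀ τ → Γ (W - v) (Del Q v) d τ ⇔ (v ∉ τ × Γ W Q d (τ ∪ ⁅ v ⁆))
link-Γ {W = W} {Q} {d} {v} v∈W τ = mk⇔ forth back
  where
  forth : Γ (W - v) (Del Q v) d τ → v ∉ τ × Γ W Q d (τ ∪ ⁅ v ⁆)
  forth (τ⊆ , e , (e⊆ , ∣e∣≡d , ¬Del) , τ∩e) =
    ⊆-⇒∉ τ⊆ , ∪⁅⁆⊆ (⊆-⇒⊆ τ⊆) v∈W ,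
    e , (⊆-⇒⊆ e⊆ , ∣e∣≡d , (λ Qe → ¬Del (Qe , ⊆-⇒∉ e⊆))) , Disjoint-∪⁅⁆ τ∩e (⊆-⇒∉ e⊆)
  back : v ∉ τ × Γ W Q d (τ ∪ ⁅ v ⁆) → Γ (W - v) (Del Q v) d τ
  back (v∉τ , τv⊆ , e , (e⊆ , ∣e∣≡d , ¬Qe) , τv∩e) =
    ⊆-⁺ (λ x∈τ → τv⊆ (x∈p∪q⁺ (inj₁ x∈τ))) v∉τ ,
    e , (⊆-⁺ e⊆ (τv∩e (x∈p∪⁅x⁆ τ v)) , ∣e∣≡d , (λ Dele → ¬Qe (proj₁ Dele))) ,
    (λ x∈τ → τv∩e (x∈p∪q⁺ (inj₁ x∈τ)))

Con-lift : ∀ {n} {Q : Family n} {d e v} → (∀ f → Q f → suc d ≤ ∣ f ∣) → ∣ e ∣ ≡ d →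
  v ∉ e → ¬ Con Q v e → ¬ Q (e ∪ ⁅ v ⁆)
Con-lift {Q = Q} {d} {e} {v} sz ∣e∣≡d v∉e ¬Con Qe∪v =
  ¬Con ((e ∪ ⁅ v ⁆ , Qe∪v , p∪⁅x⁆-x≡p e v v∉e) , no-smaller)
  where
  open ≤-Reasoning
  no-smaller : ∀ f → Q f → ¬ (f - v ⊂ e)
  no-smaller f Qf f-v⊂e = <-irrefl refl (begin-strict
    d               <⟨ sz f Qf ⟩
    ∣ f ∣           ≤⟨ ∣p∣≤1+∣p-x∣ f v ⟩
    suc ∣ f - v ∣   ≤⟨ p⊂q⇒∣p∣<∣q∣ f-v⊂e ⟩
    ∣ e ∣           ≡⟨ ∣e∣≡d ⟩
    d               ∎)

-- If e ∋ v is a non-circuit of minimal size, e - v is not a circuit of Q / v: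
-- a circuit f with f - v = e - v would lie inside e.
Con-drop : ∀ {n} {W : Subset n} {Q d e v} → (∀ f → Q f → d ≤ ∣ f ∣) →
  NonCircuit W Q d e → v ∈ e → ¬ Con Q v (e - v)
Con-drop {e = e} {v} sz nc v∈e ((f , Qf , f-v≡e-v) , _) = no-circuit-below sz nc f⊆e Qf
  where
  f⊆e : f ⊆ e
  f⊆e {x} x∈f with x ≟ᶠ v
  ... | yes refl = v∈e
  ... | no x≢v = ∈-⇒∈ e (subst (x ∈_) f-v≡e-v (x∈p∧x≢y⇒x∈p-y x∈f x≢v))

through-v : ∀ {n} {W : Subset n} {Q d v τ e} → v ∈ W → Exchange W Q d v → v ∉ τ →
  NonCircuit W Q d e → Disjoint τ e → ∃[ e' ] (v ∈ e' × NonCircuit W Q d e' × Disjoint τ e')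
through-v {Q = Q} {v = v} {e = e} v∈W ex v∉τ nc τ∩e with v ∈? e
... | yes v∈e = e , v∈e , nc , τ∩e
... | no v∉e with ex e nc v∉e
... | w , w∈e , ¬Q' =
  e [ w ↦ v ] , x∈p∪⁅x⁆ _ v , swap-NonCircuit {Q = Q} v∈W nc w∈e v∉e ¬Q' ,
  Disjoint-sym (Disjoint-∪⁅⁆ (λ x∈e-w → Disjoint-sym τ∩e (∈-⇒∈ e x∈e-w)) v∉τ)

deletion-Γ : ∀ {n} {W : Subset n} {Q d v} → v ∈ W → Exchange W Q (suc d) v →
  (∀ e → Q e → suc d ≤ ∣ e ∣) →
  ∀ τ → Γ (W - v) (Con Q v) d τ ⇔ (v ∉ τ × Γ W Q (suc d) τ)
deletion-Γ {W = W} {Q} {d} {v} v∈W ex sz τ = mk⇔ forth back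
  where
  forth : Γ (W - v) (Con Q v) d τ → v ∉ τ × Γ W Q (suc d) τ
  forth (τ⊆ , e , (e⊆ , ∣e∣≡d , ¬Con) , τ∩e) =
    ⊆-⇒∉ τ⊆ , ⊆-⇒⊆ τ⊆ ,
    e ∪ ⁅ v ⁆ ,
    (∪⁅⁆⊆ (⊆-⇒⊆ e⊆) v∈W ,
     trans (∣p∪⁅x⁆∣≡1+∣p∣ e v (⊆-⇒∉ e⊆)) (cong suc ∣e∣≡d) ,
     Con-lift sz ∣e∣≡d (⊆-⇒∉ e⊆) ¬Con) ,
    Disjoint-sym (Disjoint-∪⁅⁆ (Disjoint-sym τ∩e) (⊆-⇒∉ τ⊆))
  back : v ∉ τ × Γ W Q (suc d) τ → Γ (W - v) (Con Q v) d τ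
  back (v∉τ , τ⊆W , e , nc , τ∩e) with through-v v∈W ex v∉τ nc τ∩e
  ... | e' , v∈e' , nc'@(e'⊆W , ∣e'∣≡1+d , _) , τ∩e' =
    ⊆-⁺ τ⊆W v∉τ ,
    e' - v , (-⁺ e'⊆W , ∣p-x∣≡k e' v v∈e' ∣e'∣≡1+d , Con-drop sz nc' v∈e') ,
    (λ x∈τ x∈e'-v → τ∩e' x∈τ (∈-⇒∈ e' x∈e'-v))

shedding-step : ∀ {n} {W : Subset n} {Q d v} → v ∈ W → Exchange W Q (suc d) v →
  (∀ e → Q e → suc d ≤ ∣ e ∣) →
  VertexDecomposable (W - v) (Γ (W - v) (Del Q v) (suc d)) →
  VertexDecomposable (W - v) (Γ (W - v) (Con Q v) d) →
  VertexDecomposable W (Γ W Q (suc d))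
shedding-step v∈W ex sz vd-link vd-deletion =
  shed _ v∈W (exchange⇒trade v∈W ex)
    (VD-cong vd-deletion (deletion-Γ v∈W ex sz))
    (VD-cong vd-link (link-Γ v∈W))

Γ-zero : ∀ {n} {W : Subset n} {Q} → Dec (Q ∅) → VertexDecomposable W (Γ W Q 0)
Γ-zero {Q = Q} (yes Q∅) =
  void λ { τ (_ , e , (_ , ∣e∣≡0 , ¬Qe) , _) → ¬Qe (subst Q (sym (∣p∣≡0⇒p≡∅ ∣e∣≡0)) Q∅) }
Γ-zero {n} {W} (no ¬Q∅) =
  simplex W (λ x∈W → x∈W)
    (λ τ → mk⇔ proj₁ (λ τ⊆W → τ⊆W , ∅ , ((λ {x} → ⊥⊆ {x = x}) , ∣⊥∣≡0 n , ¬Q∅) , λ {x} _ → ∉⊥ {x = x}))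

Γ-small : ∀ {n} {W : Subset n} {Q d} → ∣ W ∣ < d → ∀ τ → ¬ Γ W Q d τ
Γ-small {W = W} ∣W∣<d τ (_ , e , (e⊆W , ∣e∣≡d , _) , _) =
  <⇒≱ ∣W∣<d (subst (_≤ ∣ W ∣) ∣e∣≡d (p⊆q⇒∣p∣≤∣q∣ e⊆W))

shedding-vertex : ∀ {n} {W : Subset n} {Q d} → (∀ e → Dec (Q e)) → HChordal W Q →
  (∀ e → Q e → suc d ≤ ∣ e ∣) → Nonempty W →
  (∃[ v ] (v ∈ W × Exchange W Q (suc d) v)) ⊎ (∀ τ → ¬ Γ W Q (suc d) τ)
shedding-vertex {W = W} {d = zero} Q? _ _ _ with any? (λ x → (x ∈? W) ×-dec ¬? (Q? ⁅ x ⁆))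
... | yes (v , v∈W , ¬Qv) = inj₁ (v , v∈W , loopless⇒exchange ¬Qv)
... | no no-non-loop = inj₂ (loops-only⇒Γ-empty no-non-loop)
shedding-vertex {W = W} {Q} {suc _} Q? ch sz W≢∅ with ch W Q here W≢∅
... | v , simp@(v∈W , _) = inj₁ (v , v∈W , simplicial⇒exchange Q? sz simp)

Γ-vertexDecomposable : ∀ {n} k {W : Subset n} {Q} d → ∣ W ∣ ≡ k → (∀ e → Dec (Q e)) →
  (∀ e → Q e → d ≤ ∣ e ∣) → HChordal W Q → VertexDecomposable W (Γ W Q d)
Γ-vertexDecomposable k zero _ Q? _ _ = Γ-zero (Q? ∅)
Γ-vertexDecomposable zero (suc d) ∣W∣≡0 _ _ _ =
  void (Γ-small (subst (_< suc d) (sym ∣W∣≡0) (s≤s z≤n)))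
Γ-vertexDecomposable (suc k) {W} (suc d) ∣W∣≡1+k Q? sz ch
  with shedding-vertex Q? ch sz (∣p∣≡1+k⇒nonempty W ∣W∣≡1+k)
... | inj₂ Γ-empty = void Γ-empty
... | inj₁ (v , v∈W , ex) = shedding-step v∈W ex sz
  (Γ-vertexDecomposable k (suc d) ∣W-v∣≡k (Del-dec v Q?) (λ e Dele → sz e (proj₁ Dele))
    (HChordal-del ch v∈W))
  (Γ-vertexDecomposable k d ∣W-v∣≡k (Con-dec v Q?) (Con-size v sz) (HChordal-con ch v∈W))
  where
  ∣W-v∣≡k : ∣ W - v ∣ ≡ k
  ∣W-v∣≡k = ∣p-x∣≡k W v v∈W ∣W∣≡1+k

-- If D is a decidable family of d-subsets of V, the minimal non-faces of I(D)
-- are exactly the members of D, so the Alexander dual of I(D) is Avoid V D.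
Avoid⇔AlexDual : ∀ {n} {V : Subset n} {D : Family n} {d} → (∀ e → Dec (D e)) →
  (∀ e → D e → e ⊆ V × ∣ e ∣ ≡ d) →
  ∀ σ → Avoid V D σ ⇔ AlexDual V (Ind V D) σ
Avoid⇔AlexDual {V = V} {D} D? D-uniform σ = mk⇔ forth back
  where
  forth : Avoid V D σ → AlexDual V (Ind V D) σ
  forth (σ⊆V , e , De , σ∩e) =
    e , (e⊆V , e-nonface , proper-faces) ,
    (λ x∈σ → x∈p∧x∉q⇒x∈p─q (σ⊆V x∈σ) (σ∩e x∈σ))
    where
    e⊆V : e ⊆ V
    e⊆V = proj₁ (D-uniform e De)
    e-nonface : ¬ Ind V D e
    e-nonface (_ , no-member) = no-member e De (λ x∈e → x∈e)
    proper-faces : ∀ f → f ⊂ e → Ind V D f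
    proper-faces f f⊂e@(f⊆e , _) =
      (λ x∈f → e⊆V (f⊆e x∈f)) ,
      λ g Dg g⊆f → <-irrefl refl
        (subst₂ _<_ (proj₂ (D-uniform g Dg)) (proj₂ (D-uniform e De))
          (≤-<-trans (p⊆q⇒∣p∣≤∣q∣ g⊆f) (p⊂q⇒∣p∣<∣q∣ f⊂e)))
  back : AlexDual V (Ind V D) σ → Avoid V D σ
  back (e , (e⊆V , e-nonface , _) , σ⊆V─e) with anySubset? (λ g → D? g ×-dec (g ⊆? e))
  ... | no no-member = ⊥-elim (e-nonface (e⊆V , λ g Dg g⊆e → no-member (g , Dg , g⊆e)))
  ... | yes (g , Dg , g⊆e) =
    (λ x∈σ → p─q⊆p V e (σ⊆V─e x∈σ)) , g , Dg ,
    (λ x∈σ x∈g → ∈─⇒∉ V e (σ⊆V─e x∈σ) (g⊆e x∈g))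

cd-dec : ∀ {n} (C : Clutter n) d → ∀ e → Dec (cd C d e)
cd-dec C d e = (e ⊆? V C) ×-dec ((∣ e ∣ ≟ℕ d) ×-dec ¬? (circ-dec C e))

theorem6p9 : ∀ {n : ℕ} (C : Clutter n) (d : ℕ) →
    Chordal C → MinCircuitCard C d →
    VertexDecomposable (V C) (AlexDual (V C) (Ind (V C) (cd C d)))
theorem6p9 C d chordal (_ , no-smaller-circuit) =
  VD-cong (Γ-vertexDecomposable ∣ V C ∣ d refl (circ-dec C) no-smaller-circuit chordal)
          (Avoid⇔AlexDual (cd-dec C d) (λ { e (e⊆V , ∣e∣≡d , _) → e⊆V , ∣e∣≡d }))
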